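{- Let $R$ be an integral domain with fraction field $K$, and let $\mathcal O$ be a valuation ring of $K$ such that the structure $(R,\mathcal O)$ is dp-minimal. Then $R\subseteq\mathcal O$ or $\mathcal O\subseteq R$.
   Context: Here $(R,\mathcal O)$ denotes the structure consisting of the field $K$ with its ring operations $+,\cdot,0,1$ together with unary predicates for $R$ and for $\mathcal O$. -}

module Defs where

open import Level using (Level; _⊔_)
open import Algebra.Bundles using (CommutativeRing)
open import Data.Nat using (ℕ; suc)
open import Data.Fin using (Fin)
open import Data.Vec.Functional using (_∷_)
open import Data.Product using (Σ; _×_; ∃)
open import Data.Sum using (_⊎_)
open import Relation.Nullary using (¬_)
open import Relation.Unary using (Pred; _∈_; _⊆_)
open import Relation.Binary.PropositionalEquality using (_≢_)

module _ {c ℓ : Level} (K : CommutativeRing c ℓ) where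
  open CommutativeRing K

  record IsField : Set (c ⊔ ℓ) where
    field
      1≉0     : ¬ (1# ≈ 0#)
      inverse : ∀ x → ¬ (x ≈ 0#) → ∃ λ y → x * y ≈ 1#

  record IsSubring {ℓ′ : Level} (P : Pred Carrier ℓ′) : Set (c ⊔ ℓ ⊔ ℓ′) where
    field
      respects : ∀ {x y} → x ≈ y → x ∈ P → y ∈ P
      zero∈    : 0# ∈ P
      one∈     : 1# ∈ P
      +-closed : ∀ {x y} → x ∈ P → y ∈ P → (x + y) ∈ P
      neg-closed : ∀ {x} → x ∈ P → (- x) ∈ P
      *-closed : ∀ {x y} → x ∈ P → y ∈ P → (x * y) ∈ P

  IsFractionFieldOf : {ℓ′ : Level} → Pred Carrier ℓ′ → Set (c ⊔ ℓ ⊔ ℓ′)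
  IsFractionFieldOf R = ∀ x → Σ Carrier λ a → Σ Carrier λ b →
    a ∈ R × b ∈ R × ¬ (b ≈ 0#) × (x * b ≈ a)

  record IsValuationRing {ℓ′ : Level} (O : Pred Carrier ℓ′) : Set (c ⊔ ℓ ⊔ ℓ′) where
    field
      subring   : IsSubring O
      valuation : ∀ x → ¬ (x ≈ 0#) → x ∈ O ⊎ (∃ λ y → x * y ≈ 1# × y ∈ O)

data Term (n : ℕ) : Set where
  var  : Fin n → Term n
  `0 `1 : Term n
  _`+_ _`*_ : Term n → Term n → Term n

data Formula : ℕ → Set where
  _`≈_ : ∀ {n} → Term n → Term n → Formula n
  `R `O : ∀ {n} → Term n → Formula n
  `¬_ : ∀ {n} → Formula n → Formula n
  _`∧_ _`∨_ : ∀ {n} → Formula n → Formula n → Formula n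
  `∃ `∀ : ∀ {n} → Formula (suc n) → Formula n

module Structure {c ℓ : Level} (K : CommutativeRing c ℓ)
                 (R O : Pred (CommutativeRing.Carrier K) ℓ) where
  open CommutativeRing K

  evalT : ∀ {n} → Term n → (Fin n → Carrier) → Carrier
  evalT (var i) ρ = ρ i
  evalT `0 ρ = 0#
  evalT `1 ρ = 1#
  evalT (s `+ t) ρ = evalT s ρ + evalT t ρ
  evalT (s `* t) ρ = evalT s ρ * evalT t ρ

  ⟦_⟧ : ∀ {n} → Formula n → (Fin n → Carrier) → Set (c ⊔ ℓ)
  ⟦ s `≈ t ⟧ ρ = Level.Lift c (evalT s ρ ≈ evalT t ρ)
  ⟦ `R t ⟧ ρ = Level.Lift c (evalT t ρ ∈ R)
  ⟦ `O t ⟧ ρ = Level.Lift c (evalT t ρ ∈ O)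
  ⟦ `¬ φ ⟧ ρ = ¬ ⟦ φ ⟧ ρ
  ⟦ φ `∧ ψ ⟧ ρ = ⟦ φ ⟧ ρ × ⟦ ψ ⟧ ρ
  ⟦ φ `∨ ψ ⟧ ρ = ⟦ φ ⟧ ρ ⊎ ⟦ ψ ⟧ ρ
  ⟦ `∃ φ ⟧ ρ = Σ Carrier λ x → ⟦ φ ⟧ (x ∷ ρ)
  ⟦ `∀ φ ⟧ ρ = ∀ x → ⟦ φ ⟧ (x ∷ ρ)

  -- A finite ict-pattern of depth 2 and size n for the partitioned formulas
  -- φ(x; ȳ), ψ(x; z̄) (variable 0 is the single object variable x, the other
  -- variables are parameter variables): parameter tuples a₀..a_{n-1}, b₀..b_{n-1}
  -- such that for all i, j some x satisfies φ(x, a_i') iff i' = i and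
  -- ψ(x, b_j') iff j' = j.
  ICTPattern : ∀ {m k} → Formula (suc m) → Formula (suc k) → ℕ → Set (c ⊔ ℓ)
  ICTPattern {m} {k} φ ψ n =
    Σ (Fin n → Fin m → Carrier) λ a → Σ (Fin n → Fin k → Carrier) λ b →
      ∀ i j → Σ Carrier λ x →
        (⟦ φ ⟧ (x ∷ a i) × (∀ i′ → i′ ≢ i → ¬ ⟦ φ ⟧ (x ∷ a i′))) ×
        (⟦ ψ ⟧ (x ∷ b j) × (∀ j′ → j′ ≢ j → ¬ ⟦ ψ ⟧ (x ∷ b j′)))

  -- dp-minimality: there is no ict-pattern of depth 2 (in the monster model);
  -- by compactness this means: for no pair φ, ψ are there ict-patterns of
  -- every finite size in the structure itself.
  DpMinimal : Set (c ⊔ ℓ)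
  DpMinimal = ∀ {m k} (φ : Formula (suc m)) (ψ : Formula (suc k)) →
    ¬ (∀ n → ICTPattern φ ψ n)

-- If R and O were incomparable, pick r ∈ R ∖ O and o ∈ O ∖ R; the inverse t of r lies
-- in the maximal ideal of O. We exhibit ict-patterns of every finite size for the
-- formulas x − a ∈ O and x − b ∈ R: the powers rⁱ are pairwise incongruent modulo O,
-- and O meets infinitely many cosets of R. For the latter, suppose O were covered by
-- k cosets of R. For X ∈ O with X⁻¹ ∈ R and y ∈ O, pigeonhole among y, X y, …, Xᵏ y
-- gives y ≡ Xᵈ y (mod R) with 1 ≤ d ≤ k. With y = 1, X = t this puts T = tᵈ into R,
-- and iterating then gives y ≡ T^{k!} y (mod R) for every y ∈ O. Since 1 − T^{k!} is a
-- unit of O, y = o / (1 − T^{k!}) lies in O, and o = y − T^{k!} y ∈ R.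
module Submission where

open import Level using (Level; _⊔_; Lift; lift; lower)
open import Algebra.Bundles using (CommutativeRing)
import Algebra.Properties.CommutativeSemigroup as CommutativeSemigroupProperties
import Algebra.Properties.Ring as RingProperties
import Algebra.Properties.Semiring.Exp as SemiringExp
open import Axiom.ExcludedMiddle using (ExcludedMiddle)
open import Data.Empty using (⊥-elim)
open import Data.Fin as Fin using (Fin; toℕ)
open import Data.Fin.Properties using (pigeonhole; ¬∀⟶∃¬; toℕ-injective; toℕ≤pred[n])
open import Data.Nat as ℕ using (zero; suc; NonZero; s≤s; _!)
open import Data.Nat.Divisibility using (divides; ∣-trans; m∣m*n; m≤n⇒m!∣n!)
import Data.Nat.Properties as ℕₚ
open import Data.Product using (∃; ∃₂; _×_; _,_; proj₁; proj₂; map₂)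
open import Data.Sum using (_⊎_; inj₁; inj₂)
open import Data.Vec.Functional using (_∷_)
open import Relation.Binary.Definitions using (tri<; tri≈; tri>)
open import Relation.Binary.PropositionalEquality as ≡ using (_≡_)
open import Relation.Nullary using (¬_; yes; no; ¬?)
open import Relation.Nullary.Decidable using (map′; decidable-stable)
open import Relation.Unary using (Pred; _∈_; _∉_; _⊆_)

open import Defs

lower-em : ∀ {a} b → ExcludedMiddle (a ⊔ b) → ExcludedMiddle a
lower-em b em = map′ lower lift (em {Lift b _})

⊆-or-counterexample : ∀ {a ℓ} {A : Set a} → ExcludedMiddle (a ⊔ ℓ) → (P Q : Pred A ℓ) →
                      P ⊆ Q ⊎ ∃ λ x → x ∈ P × x ∉ Q
⊆-or-counterexample {a} em P Q with em {∃ λ x → x ∈ P × x ∉ Q}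
... | yes counterexample = inj₂ counterexample
... | no ¬counterexample =
  inj₁ λ x∈P → decidable-stable (lower-em a em) (λ x∉Q → ¬counterexample (_ , x∈P , x∉Q))

module Congruence {c ℓ} (K : CommutativeRing c ℓ) where
  open CommutativeRing K
  open RingProperties ring
  open SemiringExp semiring public using (_^_)
  open SemiringExp semiring using (^-homo-*; ^-assocʳ; ^-congʳ)
  open import Relation.Binary.Reasoning.Setoid setoid
  private
    module * = CommutativeSemigroupProperties *-commutativeSemigroup

  infix 4 _∼_[mod_]
  _∼_[mod_] : ∀ {ℓ′} → Carrier → Carrier → Pred Carrier ℓ′ → Set ℓ′
  x ∼ y [mod P ] = (x - y) ∈ P

  IsCosetCover : ∀ {ℓ₁ ℓ₂} → Pred Carrier ℓ₁ → Pred Carrier ℓ₂ → ∀ {k} → (Fin k → Carrier) →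
                 Set (c ⊔ ℓ₁ ⊔ ℓ₂)
  IsCosetCover H S C = ∀ {y} → y ∈ S → ∃ λ i → y ∼ C i [mod H ]

  InjectiveMod : ∀ {ℓ′} → Pred Carrier ℓ′ → ∀ {n} → (Fin n → Carrier) → Set ℓ′
  InjectiveMod H C = ∀ {i j} → C i ∼ C j [mod H ] → i ≡ j

  ^-inverse : ∀ {x y} → x * y ≈ 1# → ∀ n → x ^ n * y ^ n ≈ 1#
  ^-inverse xy≈1 zero = *-identityˡ 1#
  ^-inverse {x} {y} xy≈1 (suc n) = begin
    (x * x ^ n) * (y * y ^ n) ≈⟨ *.interchange x (x ^ n) y (y ^ n) ⟩
    (x * y) * (x ^ n * y ^ n) ≈⟨ *-cong xy≈1 (^-inverse xy≈1 n) ⟩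
    1# * 1#                   ≈⟨ *-identityˡ 1# ⟩
    1#                        ∎

  module _ {ℓ′} {P : Pred Carrier ℓ′} (P-subring : IsSubring K P) where
    open IsSubring P-subring

    ^-closed : ∀ {x} n → x ∈ P → x ^ n ∈ P
    ^-closed zero    x∈P = one∈
    ^-closed (suc n) x∈P = *-closed x∈P (^-closed n x∈P)

    ∼-refl : ∀ {x} → x ∼ x [mod P ]
    ∼-refl = respects (sym (-‿inverseʳ _)) zero∈

    ∼-sym : ∀ {x y} → x ∼ y [mod P ] → y ∼ x [mod P ]
    ∼-sym {x} {y} x∼y = respects (⁻¹-anti-homo‿- x y) (neg-closed x∼y)

    ∼-trans : ∀ {x y z} → x ∼ y [mod P ] → y ∼ z [mod P ] → x ∼ z [mod P ]
    ∼-trans {x} {y} {z} x∼y y∼z = respects telescope (+-closed x∼y y∼z)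
      where
      telescope : (x - y) + (y - z) ≈ x - z
      telescope = begin
        (x - y) + (y - z)   ≈⟨ +-assoc x (- y) (y - z) ⟩
        x + (- y + (y - z)) ≈⟨ +-congˡ (+-assoc (- y) y (- z)) ⟨
        x + ((- y + y) - z) ≈⟨ +-congˡ (+-congʳ (-‿inverseˡ y)) ⟩
        x + (0# - z)        ≈⟨ +-congˡ (+-identityˡ (- z)) ⟩
        x - z               ∎

    ∼-resp : ∀ {x x′ y y′} → x ≈ x′ → y ≈ y′ → x ∼ y [mod P ] → x′ ∼ y′ [mod P ]
    ∼-resp x≈x′ y≈y′ = respects (+-cong x≈x′ (-‿cong y≈y′))

    ∼-*ˡ : ∀ {u x y} → u ∈ P → x ∼ y [mod P ] → u * x ∼ u * y [mod P ]
    ∼-*ˡ {u} {x} {y} u∈P x∼y = respects (x[y-z]≈xy-xz u x y) (*-closed u∈P x∼y)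

    ∈-resp-∼ : ∀ {x y} → x ∈ P → x ∼ y [mod P ] → y ∈ P
    ∈-resp-∼ {x} {y} x∈P x∼y = respects y-x+x≈y (+-closed (neg-closed x∼y) x∈P)
      where
      y-x+x≈y : - (x - y) + x ≈ y
      y-x+x≈y = begin
        - (x - y) + x ≈⟨ +-congʳ (⁻¹-anti-homo‿- x y) ⟩
        (y - x) + x   ≈⟨ //-rightDividesˡ x y ⟩
        y             ∎

    ∼-witness : ∀ {x a z} → z + a ≈ x → z ∈ P → x ∼ a [mod P ]
    ∼-witness {x} {a} {z} z+a≈x z∈P = respects z≈x-a z∈P
      where
      z≈x-a : z ≈ x - a
      z≈x-a = begin
        z           ≈⟨ //-rightDividesʳ a z ⟨
        (z + a) - a ≈⟨ +-congʳ z+a≈x ⟩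
        x - a       ∎

    ∼-iterate : ∀ {u y} → u ∈ P → y ∼ u * y [mod P ] → ∀ q → y ∼ u ^ q * y [mod P ]
    ∼-iterate {u} {y} u∈P y∼uy zero    = ∼-resp refl (sym (*-identityˡ y)) ∼-refl
    ∼-iterate {u} {y} u∈P y∼uy (suc q) =
      ∼-trans (∼-iterate u∈P y∼uy q)
        (∼-resp refl (*.x∙yz≈yx∙z (u ^ q) u y) (∼-*ˡ (^-closed q u∈P) y∼uy))

    ∼-cancel-powers : ∀ {X X⁻¹ y a b} → X * X⁻¹ ≈ 1# → X⁻¹ ∈ P → a ℕ.< b →
                      X ^ a * y ∼ X ^ b * y [mod P ] →
                      ∃ λ d → suc a ℕ.+ d ≡ b × y ∼ X ^ suc d * y [mod P ]
    ∼-cancel-powers {X} {X⁻¹} {y} {a} {b} inverse X⁻¹∈P a<b Xᵃy∼Xᵇy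
      with ℕₚ.m≤n⇒∃[o]m+o≡n a<b
    ... | d , a+1+d≡b = d , a+1+d≡b ,
      ∼-resp (cancel y) (cancel (X ^ suc d * y))
        (∼-*ˡ (^-closed a X⁻¹∈P) (∼-resp refl split Xᵃy∼Xᵇy))
      where
      cancel : ∀ w → X⁻¹ ^ a * (X ^ a * w) ≈ w
      cancel w = begin
        X⁻¹ ^ a * (X ^ a * w) ≈⟨ *-assoc (X⁻¹ ^ a) (X ^ a) w ⟨
        (X⁻¹ ^ a * X ^ a) * w ≈⟨ *-congʳ (trans (*-comm _ _) (^-inverse inverse a)) ⟩
        1# * w                ≈⟨ *-identityˡ w ⟩
        w                     ∎
      split : X ^ b * y ≈ X ^ a * (X ^ suc d * y)
      split = begin
        X ^ b * y               ≈⟨ *-congʳ (^-congʳ X (≡.trans (≡.sym a+1+d≡b) (≡.sym (ℕₚ.+-suc a d)))) ⟩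
        X ^ (a ℕ.+ suc d) * y   ≈⟨ *-congʳ (^-homo-* X a (suc d)) ⟩
        (X ^ a * X ^ suc d) * y ≈⟨ *-assoc _ _ _ ⟩
        X ^ a * (X ^ suc d * y) ∎

    powers-incongruent : ∀ {x y} → x ∉ P → y ∈ P → x * y ≈ 1# →
                         ∀ {a b} → a ℕ.< b → ¬ x ^ a ∼ x ^ b [mod P ]
    powers-incongruent {x} {y} x∉P y∈P xy≈1 a<b xᵃ∼xᵇ
      with ∼-cancel-powers xy≈1 y∈P a<b (∼-resp (sym (*-identityʳ _)) (sym (*-identityʳ _)) xᵃ∼xᵇ)
    ... | d , _ , 1∼xᵈ⁺¹ = x∉P (respects xᵈ⁺¹yᵈ≈x (*-closed xᵈ⁺¹∈P (^-closed d y∈P)))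
      where
      xᵈ⁺¹∈P : x ^ suc d ∈ P
      xᵈ⁺¹∈P = respects (*-identityʳ _) (∈-resp-∼ one∈ 1∼xᵈ⁺¹)
      xᵈ⁺¹yᵈ≈x : x ^ suc d * y ^ d ≈ x
      xᵈ⁺¹yᵈ≈x = begin
        (x * x ^ d) * y ^ d ≈⟨ *-assoc x (x ^ d) (y ^ d) ⟩
        x * (x ^ d * y ^ d) ≈⟨ *-congˡ (^-inverse xy≈1 d) ⟩
        x * 1#              ≈⟨ *-identityʳ x ⟩
        x                   ∎

    powers-injectiveMod : ∀ {x y} → x ∉ P → y ∈ P → x * y ≈ 1# →
                          ∀ {n} → InjectiveMod P (λ (i : Fin n) → x ^ toℕ i)
    powers-injectiveMod x∉P y∈P xy≈1 {i = i} {j} xⁱ∼xʲ with ℕₚ.<-cmp (toℕ i) (toℕ j)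
    ... | tri< i<j _ _ = ⊥-elim (powers-incongruent x∉P y∈P xy≈1 i<j xⁱ∼xʲ)
    ... | tri≈ _ i≡j _ = toℕ-injective i≡j
    ... | tri> _ _ j<i = ⊥-elim (powers-incongruent x∉P y∈P xy≈1 j<i (∼-sym xⁱ∼xʲ))

  module _ {ℓ₁ ℓ₂} {H : Pred Carrier ℓ₁} {S : Pred Carrier ℓ₂}
           (H-subring : IsSubring K H) (S-subring : IsSubring K S)
           {k} {C : Fin k → Carrier} (cover : IsCosetCover H S C) where

    cover-pigeonhole : (g : Fin (suc k) → Carrier) → (∀ a → g a ∈ S) →
                       ∃₂ λ a b → toℕ a ℕ.< toℕ b × g a ∼ g b [mod H ]
    cover-pigeonhole g g∈S with pigeonhole (ℕₚ.n<1+n k) (λ a → proj₁ (cover (g∈S a)))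
    ... | a , b , a<b , same = a , b , a<b ,
      ∼-trans H-subring (proj₂ (cover (g∈S a)))
        (∼-sym H-subring (≡.subst (λ i → g b ∼ C i [mod H ]) (≡.sym same) (proj₂ (cover (g∈S b)))))

    recurrence : ∀ {X X⁻¹ y} → X * X⁻¹ ≈ 1# → X⁻¹ ∈ H → X ∈ S → y ∈ S →
                 ∃ λ d → d ℕ.< k × y ∼ X ^ suc d * y [mod H ]
    recurrence {X} {X⁻¹} {y} inverse X⁻¹∈H X∈S y∈S
      with cover-pigeonhole (λ a → X ^ toℕ a * y)
             (λ a → IsSubring.*-closed S-subring (^-closed S-subring (toℕ a) X∈S) y∈S)
    ... | a , b , a<b , Xᵃy∼Xᵇy with ∼-cancel-powers H-subring inverse X⁻¹∈H a<b Xᵃy∼Xᵇy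
    ...   | d , a+1+d≡b , y∼Xᵈ⁺¹y = d , d<k , y∼Xᵈ⁺¹y
      where
      d<k : d ℕ.< k
      d<k = ℕₚ.≤-trans (s≤s (ℕₚ.m≤n+m d (toℕ a)))
                       (≡.subst (ℕ._≤ k) (≡.sym a+1+d≡b) (toℕ≤pred[n] b))

    -- Every 1 ≤ d ≤ k divides k!, so one exponent serves every y.
    factorial-recurrence : ∀ {X X⁻¹ y} → X * X⁻¹ ≈ 1# → X⁻¹ ∈ H → X ∈ H → X ∈ S → y ∈ S →
                           y ∼ X ^ (k !) * y [mod H ]
    factorial-recurrence {X} {X⁻¹} {y} inverse X⁻¹∈H X∈H X∈S y∈S
      with recurrence inverse X⁻¹∈H X∈S y∈S
    ... | d , d<k , y∼Xᵈ⁺¹y with ∣-trans (m∣m*n (d !)) (m≤n⇒m!∣n! d<k)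
    ...   | divides q k!≡q[1+d] =
      ∼-resp H-subring refl (*-congʳ power)
        (∼-iterate H-subring (^-closed H-subring (suc d) X∈H) y∼Xᵈ⁺¹y q)
      where
      power : (X ^ suc d) ^ q ≈ X ^ (k !)
      power = trans (^-assocʳ X (suc d) q)
                    (^-congʳ X (≡.trans (ℕₚ.*-comm (suc d) q) (≡.sym k!≡q[1+d])))

  module _ {ℓ′} (em : ExcludedMiddle (c ⊔ ℓ′)) {H S : Pred Carrier ℓ′} (H-subring : IsSubring K H) where

    uncovered-point : ∀ {k} (C : Fin k → Carrier) → ¬ IsCosetCover H S C →
                      ∃ λ y → y ∈ S × (∀ i → ¬ y ∼ C i [mod H ])
    uncovered-point {k} C ¬cover with em {∃ λ y → y ∈ S × (∀ i → ¬ y ∼ C i [mod H ])}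
    ... | yes uncovered = uncovered
    ... | no ¬uncovered = ⊥-elim (¬cover covered)
      where
      covered : IsCosetCover H S C
      covered {y} y∈S = map₂ (decidable-stable (lower-em c em))
        (¬∀⟶∃¬ k (λ i → ¬ y ∼ C i [mod H ]) (λ i → ¬? (lower-em c em))
          (λ y≁C → ¬uncovered (y , y∈S , y≁C)))

    injective-family : (∀ {k} (C : Fin k → Carrier) → ¬ IsCosetCover H S C) →
                       ∀ n → ∃ λ (C : Fin n → Carrier) → (∀ i → C i ∈ S) × InjectiveMod H C
    injective-family ¬cover zero = (λ ()) , (λ ()) , λ { {()} }
    injective-family ¬cover (suc n) with injective-family ¬cover n
    ... | C , C∈S , C-injective with uncovered-point C (¬cover C)
    ...   | y , y∈S , y≁C = (y ∷ C) , y∷C∈S , y∷C-injective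
      where
      y∷C∈S : ∀ i → (y ∷ C) i ∈ S
      y∷C∈S Fin.zero    = y∈S
      y∷C∈S (Fin.suc i) = C∈S i

      y∷C-injective : InjectiveMod H (y ∷ C)
      y∷C-injective {Fin.zero}  {Fin.zero}  _     = ≡.refl
      y∷C-injective {Fin.zero}  {Fin.suc j} y∼Cⱼ  = ⊥-elim (y≁C j y∼Cⱼ)
      y∷C-injective {Fin.suc i} {Fin.zero}  Cᵢ∼y  = ⊥-elim (y≁C i (∼-sym H-subring Cᵢ∼y))
      y∷C-injective {Fin.suc i} {Fin.suc j} Cᵢ∼Cⱼ = ≡.cong Fin.suc (C-injective Cᵢ∼Cⱼ)

module ValuationRing {c ℓ} (K : CommutativeRing c ℓ) {ℓ′} {O : Pred (CommutativeRing.Carrier K) ℓ′}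
                     (O-valuation : IsValuationRing K O) where
  open CommutativeRing K
  open RingProperties ring
  open Congruence K
  open IsValuationRing O-valuation
  open import Relation.Binary.Reasoning.Setoid setoid
  private
    module O = IsSubring subring
    module * = CommutativeSemigroupProperties *-commutativeSemigroup

  IsNonUnit : Carrier → Set (c ⊔ ℓ ⊔ ℓ′)
  IsNonUnit x = ∀ {z} → z ∈ O → ¬ x * z ≈ 1#

  *-nonUnit : ∀ {x y} → IsNonUnit x → y ∈ O → IsNonUnit (x * y)
  *-nonUnit {x} {y} x-nonUnit y∈O z∈O xyz≈1 =
    x-nonUnit (O.*-closed y∈O z∈O) (trans (sym (*-assoc x y _)) xyz≈1)

  ^-nonUnit : ∀ {x} → x ∈ O → IsNonUnit x → ∀ n .{{_ : NonZero n}} → IsNonUnit (x ^ n)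
  ^-nonUnit x∈O x-nonUnit (suc n) = *-nonUnit x-nonUnit (^-closed subring n x∈O)

  ∉⇒inverse∈ : ∀ {x} → x ∉ O → ∃ λ y → x * y ≈ 1# × y ∈ O
  ∉⇒inverse∈ x∉O with valuation _ (λ x≈0 → x∉O (O.respects (sym x≈0) O.zero∈))
  ... | inj₁ x∈O    = ⊥-elim (x∉O x∈O)
  ... | inj₂ inverse = inverse

  inverse-nonUnit : ∀ {x y} → x ∉ O → x * y ≈ 1# → IsNonUnit y
  inverse-nonUnit {x} {y} x∉O xy≈1 {z} z∈O yz≈1 = x∉O (O.respects z≈x z∈O)
    where
    z≈x : z ≈ x
    z≈x = begin
      z           ≈⟨ *-identityˡ z ⟨
      1# * z      ≈⟨ *-congʳ xy≈1 ⟨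
      (x * y) * z ≈⟨ *-assoc x y z ⟩
      x * (y * z) ≈⟨ *-congˡ yz≈1 ⟩
      x * 1#      ≈⟨ *-identityʳ x ⟩
      x           ∎

  1-nonUnit-invertible : ExcludedMiddle ℓ → IsField K → ∀ {x} → IsNonUnit x →
                         ∃ λ w → w ∈ O × (1# - x) * w ≈ 1#
  1-nonUnit-invertible em K-field {x} x-nonUnit with IsField.inverse K-field (1# - x) 1-x≉0
    where
    1-x≉0 : ¬ 1# - x ≈ 0#
    1-x≉0 1-x≈0 = x-nonUnit O.one∈ (trans (*-identityʳ x) (sym (x∙y⁻¹≈ε⇒x≈y 1# x 1-x≈0)))
  ... | w , [1-x]w≈1 = w , w∈O , [1-x]w≈1
    where
    w≈1+xw : w ≈ 1# + x * w
    w≈1+xw = begin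
      w                        ≈⟨ //-rightDividesˡ (x * w) w ⟨
      (w - x * w) + x * w      ≈⟨ +-congʳ (+-congʳ (*-identityˡ w)) ⟨
      (1# * w - x * w) + x * w ≈⟨ +-congʳ ([y-z]x≈yx-zx w 1# x) ⟨
      (1# - x) * w + x * w     ≈⟨ +-congʳ [1-x]w≈1 ⟩
      1# + x * w               ∎

    -- By w = 1 + x w: if x w ∈ O then w ∈ O, and if x w has an inverse z ∈ O then
    -- x (w z) = 1 with w z = z + 1 ∈ O.
    w∈O : w ∈ O
    w∈O with em {x * w ≈ 0#}
    ... | yes xw≈0 = O.respects (sym (trans w≈1+xw (trans (+-congˡ xw≈0) (+-identityʳ 1#)))) O.one∈
    ... | no xw≉0 with valuation (x * w) xw≉0
    ...   | inj₁ xw∈O = O.respects (sym w≈1+xw) (O.+-closed O.one∈ xw∈O)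
    ...   | inj₂ (z , xwz≈1 , z∈O) =
      ⊥-elim (x-nonUnit (O.respects (sym wz≈z+1) (O.+-closed z∈O O.one∈))
                        (trans (sym (*-assoc x w z)) xwz≈1))
      where
      wz≈z+1 : w * z ≈ z + 1#
      wz≈z+1 = begin
        w * z                ≈⟨ *-congʳ w≈1+xw ⟩
        (1# + x * w) * z     ≈⟨ distribʳ z 1# (x * w) ⟩
        1# * z + (x * w) * z ≈⟨ +-cong (*-identityˡ z) xwz≈1 ⟩
        z + 1#               ∎

  module _ (em : ExcludedMiddle ℓ) (K-field : IsField K) {ℓ″} {R : Pred Carrier ℓ″}
           (R-subring : IsSubring K R) {k} {C : Fin k → Carrier} (cover : IsCosetCover R O C) where
    private
      module R = IsSubring R-subring

    cosetCover⇒⊆′ : ∀ {X X⁻¹} → X ∈ O → IsNonUnit X → X ∈ R → X⁻¹ ∈ R → X * X⁻¹ ≈ 1# → O ⊆ R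
    cosetCover⇒⊆′ {X} X∈O X-nonUnit X∈R X⁻¹∈R inverse {o} o∈O
      with 1-nonUnit-invertible em K-field (^-nonUnit X∈O X-nonUnit (k !) {{k ℕₚ.!≢0}})
    ... | w , w∈O , [1-P]w≈1 =
      R.respects o-eq
        (factorial-recurrence R-subring subring cover inverse X⁻¹∈R X∈R X∈O (O.*-closed o∈O w∈O))
      where
      P : Carrier
      P = X ^ (k !)
      o-eq : o * w - P * (o * w) ≈ o
      o-eq = begin
        o * w - P * (o * w)        ≈⟨ +-congʳ (*-identityˡ (o * w)) ⟨
        1# * (o * w) - P * (o * w) ≈⟨ [y-z]x≈yx-zx (o * w) 1# P ⟨
        (1# - P) * (o * w)         ≈⟨ *.x∙yz≈y∙xz (1# - P) o w ⟩
        o * ((1# - P) * w)         ≈⟨ *-congˡ [1-P]w≈1 ⟩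
        o * 1#                     ≈⟨ *-identityʳ o ⟩
        o                          ∎

    cosetCover⇒⊆ : ∀ {t r} → t ∈ O → IsNonUnit t → r ∈ R → t * r ≈ 1# → O ⊆ R
    cosetCover⇒⊆ {t} {r} t∈O t-nonUnit r∈R tr≈1 with recurrence R-subring subring cover tr≈1 r∈R t∈O O.one∈
    ... | d , _ , 1∼tᵈ⁺¹ =
      cosetCover⇒⊆′ (^-closed subring (suc d) t∈O) (^-nonUnit t∈O t-nonUnit (suc d))
        (R.respects (*-identityʳ _) (∈-resp-∼ R-subring R.one∈ 1∼tᵈ⁺¹))
        (^-closed R-subring (suc d) r∈R) (^-inverse tr≈1 (suc d))

module DpMinimality {c ℓ} (K : CommutativeRing c ℓ) (R O : Pred (CommutativeRing.Carrier K) ℓ)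
                    (R-subring : IsSubring K R) (O-valuation : IsValuationRing K O) where
  open CommutativeRing K
  open Congruence K
  open ValuationRing K O-valuation
  open Structure K R O
  private
    O-subring : IsSubring K O
    O-subring = IsValuationRing.subring O-valuation

  -- x − a ∈ P, written as ∃ z. z + a = x ∧ P z (variables z, x, a are 0, 1, 2).
  differenceIn : (∀ {n} → Term n → Formula n) → Formula 2
  differenceIn `P =
    `∃ (((var Fin.zero `+ var (Fin.suc (Fin.suc Fin.zero))) `≈ var (Fin.suc Fin.zero)) `∧ `P (var Fin.zero))

  injectiveMod⇒ICTPattern : ∀ {n} {A C : Fin n → Carrier} →
                            (∀ i → A i ∈ R) → InjectiveMod O A → (∀ j → C j ∈ O) → InjectiveMod R C →
                            ICTPattern (differenceIn `O) (differenceIn `R) n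
  injectiveMod⇒ICTPattern {A = A} {C} A∈R A-injective C∈O C-injective =
    (λ i _ → A i) , (λ j _ → C j) , λ i j →
      A i + C j ,
      ((C j , lift (+-comm (C j) (A i)) , lift (C∈O j)) ,
       λ { i′ i′≢i (z , lift z+Aᵢ′≈x , lift z∈O) → i′≢i (≡.sym (A-injective
             (∼-trans O-subring (∼-sym O-subring (∼-witness O-subring (+-comm (C j) (A i)) (C∈O j)))
                                (∼-witness O-subring z+Aᵢ′≈x z∈O)))) }) ,
      ((A i , lift refl , lift (A∈R i)) ,
       λ { j′ j′≢j (z , lift z+Cⱼ′≈x , lift z∈R) → j′≢j (≡.sym (C-injective
             (∼-trans R-subring (∼-sym R-subring (∼-witness R-subring refl (A∈R i)))
                                (∼-witness R-subring z+Cⱼ′≈x z∈R)))) })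

  incomparable⇒ICTPatterns : ExcludedMiddle (c ⊔ ℓ) → IsField K → ∀ {r t o} →
                             r ∈ R → r ∉ O → t ∈ O → r * t ≈ 1# → o ∈ O → o ∉ R →
                             ∀ n → ICTPattern (differenceIn `O) (differenceIn `R) n
  incomparable⇒ICTPatterns em K-field {r} {t} r∈R r∉O t∈O rt≈1 o∈O o∉R n =
    let C , C∈O , C-injective = injective-family em R-subring no-cover n
    in injectiveMod⇒ICTPattern (λ i → ^-closed R-subring (toℕ i) r∈R)
         (powers-injectiveMod O-subring r∉O t∈O rt≈1) C∈O C-injective
    where
    no-cover : ∀ {k} (C : Fin k → Carrier) → ¬ IsCosetCover R O C
    no-cover C cover = o∉R (cosetCover⇒⊆ (lower-em c em) K-field R-subring cover t∈O
                              (inverse-nonUnit r∉O rt≈1) r∈R (trans (*-comm t r) rt≈1) o∈O)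

  incomparable⇒¬DpMinimal : ExcludedMiddle (c ⊔ ℓ) → IsField K →
                            ∀ {r o} → r ∈ R → r ∉ O → o ∈ O → o ∉ R → ¬ DpMinimal
  incomparable⇒¬DpMinimal em K-field r∈R r∉O o∈O o∉R dpMinimal =
    let t , rt≈1 , t∈O = ∉⇒inverse∈ r∉O
    in dpMinimal (differenceIn `O) (differenceIn `R)
         (incomparable⇒ICTPatterns em K-field r∈R r∉O t∈O rt≈1 o∈O o∉R)

corollary5p6 : {c ℓ : Level} → ExcludedMiddle (c ⊔ ℓ) →
    (K : CommutativeRing c ℓ) → IsField K →
    (R O : Pred (CommutativeRing.Carrier K) ℓ) →
    IsSubring K R → IsFractionFieldOf K R →
    IsValuationRing K O →
    Structure.DpMinimal K R O →
    (R ⊆ O) ⊎ (O ⊆ R)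
corollary5p6 em K K-field R O R-subring _ O-valuation dpMinimal
  with ⊆-or-counterexample em R O | ⊆-or-counterexample em O R
... | inj₁ R⊆O | _        = inj₁ R⊆O
... | inj₂ _   | inj₁ O⊆R = inj₂ O⊆R
... | inj₂ (r , r∈R , r∉O) | inj₂ (o , o∈O , o∉R) =
  ⊥-elim (DpMinimality.incomparable⇒¬DpMinimal K R O R-subring O-valuation em K-field r∈R r∉O o∈O o∉R dpMinimal)
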